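{- Let $\Gamma$ be a residually connected incidence geometry over $I=\{0,\dots,n-1\}$, $n\ge3$, satisfying $(B_1)$ and $(B_2)$ for $\{0,1\}$, with $\Gamma[0,1]$ not bipartite. Let $G$ be a group of automorphisms of $\Gamma$ acting transitively on the chambers of $\Gamma$. Then $G$ also acts transitively by automorphisms on the chambers of $\mathcal{P}(\Gamma)(0,1)$, where $\sigma\in G$ acts by $\mathcal{P}(\sigma)(p,i)=(\sigma(p),i)$ for $i\in\{0,1\}$ and $\mathcal{P}(\sigma)(x,P)=(\sigma(x),\sigma(P))$.
   Context: Standard notions: incidence geometry, flags, chambers, residues, truncations, automorphisms (type-preserving incidence-preserving bijections), $S_i=t^{ -1}(i)$, $\sigma_0(x)$ = $0$-elements incident to $x$. $(B_1)$: $\Gamma[0,1]$ is the geometry of a simple graph (vertices = $0$-elements, edges = $1$-elements); $p\sim q$ denotes adjacency. $(B_2)$: for an edge $e$ and $x$ of type $\notin\{0,1\}$, $e*x$ iff $\sigma_0(e)\subseteq\sigma_0(x)$. For a connected graph $\mathcal{G}$ on $V$, $\pi(\mathcal{G})$ is the set of classes of "joined by an even walk"; $\bar P=V\setminus P$ if $\mathcal{G}$ is bipartite, $\bar P=P$ otherwise. $\mathcal{P}(\Gamma)(0,1)$: elements $(p,0)$, $(p,1)$ for $p\in S_0$ (types 0, 1) and $(x,P_x)$ for $x\in S_i$, $i\ge2$, $P_x\in\pi(\Gamma_x[0,1])$ (type $i$); incidence: $(x,P_x)*'(y,P_y)$ iff $x*y$ and $P_x\cap P_y\ne\emptyset$;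 $(p,0)*'(y,P_y)$ iff $p*y$, $p\in P_y$; $(q,1)*'(y,P_y)$ iff $q*y$, $q\in\bar P_y$; $(p,0)*'(q,1)$ iff $p\sim q$. -}

module Defs where

open import Data.Nat using (ℕ; zero; suc; _+_)
open import Data.Fin using (Fin; zero; suc)
open import Data.Bool using (Bool)
open import Data.Maybe using (Maybe; just; nothing)
open import Data.Product using (Σ; ∃; ∃-syntax; _×_; _,_)
open import Data.Sum using (_⊎_)
open import Data.Empty using (⊥)
open import Relation.Nullary using (¬_)
open import Relation.Binary.PropositionalEquality using (_≡_; _≢_; trans; sym)
open import Relation.Binary.Structures using (IsEquivalence)
open import Relation.Binary.Construct.Closure.ReflexiveTransitive using (Star)
open import Function using (_∘_; id; _⇔_)

record IncidenceSystem (n : ℕ) : Set₁ where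
  field
    Carrier : Set
    _≈_     : Carrier → Carrier → Set
    typ     : Carrier → Fin n
    _∗_     : Carrier → Carrier → Set

open IncidenceSystem public using (Carrier)

module _ {n : ℕ} (S : IncidenceSystem n) where
  open IncidenceSystem S renaming (Carrier to E)

  IsChamber : (Fin n → E) → Set
  IsChamber C = (∀ i → typ (C i) ≡ i) × (∀ i j → C i ∗ C j)

  IsFlag : (Fin n → Maybe E) → Set
  IsFlag F = (∀ i x → F i ≡ just x → typ x ≡ i)
           × (∀ i j x y → F i ≡ just x → F j ≡ just y → x ∗ y)

  FlagIn : (Fin n → Maybe E) → (Fin n → E) → Set
  FlagIn F C = ∀ i x → F i ≡ just x → x ≈ C i

  InResidue : (Fin n → Maybe E) → E → Set
  InResidue F x = (F (typ x) ≡ nothing) × (∀ i y → F i ≡ just y → x ∗ y)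

  CorankAtLeast2 : (Fin n → Maybe E) → Set
  CorankAtLeast2 F = ∃[ i ] ∃[ j ] (i ≢ j × F i ≡ nothing × F j ≡ nothing)

  ResidueConnected : (Fin n → Maybe E) → Set
  ResidueConnected F =
    ∀ x y → InResidue F x → InResidue F y →
      Star (λ a b → InResidue F a × InResidue F b × a ∗ b) x y

  ResiduallyConnected : Set
  ResiduallyConnected =
    ∀ F → IsFlag F → CorankAtLeast2 F → ResidueConnected F

  record IsAutomorphism (f : E → E) : Set where
    field
      resp     : ∀ {x y} → x ≈ y → f x ≈ f y
      typ-pres : ∀ x → typ (f x) ≡ typ x
      inc      : ∀ {x y} → x ∗ y → f x ∗ f y
      inc⁻     : ∀ {x y} → f x ∗ f y → x ∗ y
      inj      : ∀ {x y} → f x ≈ f y → x ≈ y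
      surj     : ∀ y → ∃[ x ] (f x ≈ y)

  record IsAutGroup (G : (E → E) → Set) : Set where
    field
      aut  : ∀ σ → G σ → IsAutomorphism σ
      idG  : G id
      comp : ∀ {σ τ} → G σ → G τ → G (σ ∘ τ)
      inv  : ∀ {σ} → G σ →
             ∃[ τ ] (G τ × (∀ x → σ (τ x) ≈ x) × (∀ x → τ (σ x) ≈ x))

  ChamberTransitive : ((E → E) → Set) → Set
  ChamberTransitive G = ∀ C D → IsChamber C → IsChamber D →
    ∃[ σ ] (G σ × (∀ i → σ (C i) ≈ D i))

record IsGeometry {n : ℕ} (S : IncidenceSystem n) : Set where
  open IncidenceSystem S renaming (Carrier to E)
  field
    isEquiv    : IsEquivalence _≈_
    typ-resp   : ∀ {x y} → x ≈ y → typ x ≡ typ y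
    ∗-resp     : ∀ {x x' y y'} → x ≈ x' → y ≈ y' → x ∗ y → x' ∗ y'
    ∗-refl     : ∀ x → x ∗ x
    ∗-sym      : ∀ {x y} → x ∗ y → y ∗ x
    ∗-sameType : ∀ {x y} → x ∗ y → typ x ≡ typ y → x ≈ y
    flag-chamber : ∀ F → IsFlag S F → ∃[ C ] (IsChamber S C × FlagIn S F C)

module Construction {m : ℕ} (S : IncidenceSystem (suc (suc (suc m)))) where
  open IncidenceSystem S renaming (Carrier to E)

  Upper : Fin (suc (suc (suc m))) → Set
  Upper i = (i ≢ zero) × (i ≢ suc zero)

  _∈σ₀_ : E → E → Set
  p ∈σ₀ x = (typ p ≡ zero) × (p ∗ x)

  -- (B₁): Γ[0,1] is the geometry of a simple graph
  B1 : Set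
  B1 = (∀ e → typ e ≡ suc zero →
          ∃[ p ] ∃[ q ] (typ p ≡ zero × typ q ≡ zero × p ∗ e × q ∗ e × ¬ (p ≈ q)
                         × (∀ r → typ r ≡ zero → r ∗ e → (r ≈ p) ⊎ (r ≈ q))))
     × (∀ e e' → typ e ≡ suc zero → typ e' ≡ suc zero →
          (∀ p → typ p ≡ zero → (p ∗ e ⇔ p ∗ e')) → e ≈ e')

  B2 : Set
  B2 = ∀ e x → typ e ≡ suc zero → Upper (typ x) →
         (e ∗ x ⇔ (∀ p → typ p ≡ zero → p ∗ e → p ∗ x))

  Adj : E → E → Set
  Adj p q = typ p ≡ zero × typ q ≡ zero
          × (∃[ e ] (typ e ≡ suc zero × p ∗ e × q ∗ e)) × ¬ (p ≈ q)

  Bipartite : Set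
  Bipartite = Σ (E → Bool) λ c → ∀ p q → Adj p q → c p ≢ c q

  AdjIn : E → E → E → Set
  AdjIn x p q = p ∈σ₀ x × q ∈σ₀ x
              × (∃[ e ] (typ e ≡ suc zero × e ∗ x × p ∗ e × q ∗ e)) × ¬ (p ≈ q)

  BipartiteIn : E → Set
  BipartiteIn x = Σ (E → Bool) λ c → ∀ p q → AdjIn x p q → c p ≢ c q

  data WalkIn (x : E) : E → E → ℕ → Set where
    here : ∀ {p} → p ∈σ₀ x → WalkIn x p p zero
    step : ∀ {p q r k} → AdjIn x p q → WalkIn x q r k → WalkIn x p r (suc k)

  -- p and q joined by an even walk in Γ_x[0,1]; the class of π(Γ_x[0,1])
  -- represented by p is { q | EvenIn x p q }.
  EvenIn : E → E → E → Set
  EvenIn x p q = ∃[ k ] WalkIn x p q (k + k)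

  -- q ∈ P̄, where P is the class of p in π(Γ_x[0,1])
  BarMem : E → E → E → Set
  BarMem x p q = (BipartiteIn x × q ∈σ₀ x × ¬ EvenIn x p q)
               ⊎ (¬ BipartiteIn x × EvenIn x p q)

  -- elements of 𝒫(Γ)(0,1); the class P_x is given by a representative
  data PElt : Set where
    pt0 : (p : E) → typ p ≡ zero → PElt
    pt1 : (p : E) → typ p ≡ zero → PElt
    cls : (x : E) → Upper (typ x) → (p : E) → p ∈σ₀ x → PElt

  ptyp : PElt → Fin (suc (suc (suc m)))
  ptyp (pt0 _ _) = zero
  ptyp (pt1 _ _) = suc zero
  ptyp (cls x _ _ _) = typ x

  _≈P_ : PElt → PElt → Set
  pt0 p _ ≈P pt0 q _ = p ≈ q
  pt1 p _ ≈P pt1 q _ = p ≈ q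
  cls x _ p _ ≈P cls y _ q _ = x ≈ y × EvenIn x p q
  _ ≈P _ = ⊥

  _∗P_ : PElt → PElt → Set
  pt0 p _ ∗P pt0 q _ = p ≈ q
  pt1 p _ ∗P pt1 q _ = p ≈ q
  pt0 p _ ∗P pt1 q _ = Adj p q
  pt1 q _ ∗P pt0 p _ = Adj p q
  pt0 p _ ∗P cls y _ q _ = p ∗ y × EvenIn y q p
  cls y _ q _ ∗P pt0 p _ = p ∗ y × EvenIn y q p
  pt1 p _ ∗P cls y _ q _ = p ∗ y × BarMem y q p
  cls y _ q _ ∗P pt1 p _ = p ∗ y × BarMem y q p
  cls x _ p _ ∗P cls y _ q _ = x ∗ y × ∃[ r ] (EvenIn x p r × EvenIn y q r)

  PΓ : IncidenceSystem (suc (suc (suc m)))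
  PΓ = record { Carrier = PElt ; _≈_ = _≈P_ ; typ = ptyp ; _∗_ = _∗P_ }

  Pmap : (σ : E → E) → IsAutomorphism S σ → PElt → PElt
  Pmap σ a (pt0 p t) = pt0 (σ p) (trans (IsAutomorphism.typ-pres a p) t)
  Pmap σ a (pt1 p t) = pt1 (σ p) (trans (IsAutomorphism.typ-pres a p) t)
  Pmap σ a (cls x (u0 , u1) p (tp , px)) =
    cls (σ x)
        ((λ e → u0 (trans (sym (IsAutomorphism.typ-pres a x)) e)) ,
         (λ e → u1 (trans (sym (IsAutomorphism.typ-pres a x)) e)))
        (σ p)
        (trans (IsAutomorphism.typ-pres a p) tp , IsAutomorphism.inc a px)

{-# OPTIONS --safe #-}

-- A chamber {(p,0), (q,1), (x₂,P₂), …} of 𝒫(Γ)(0,1) lies over the chamber {p, pq, x₂, …} of Γ: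
-- the edge pq is incident with every xᵢ by (B₂), and p ∈ Pᵢ.  An element σ ∈ G carrying the
-- chamber below C to the chamber below D maps p to p′ and pq to p′q′, hence q to q′ by (B₁), and
-- the class of p in Γ_{xᵢ}[0,1] to the class of p′.  That 𝒫(σ) is an automorphism is the
-- invariance under σ of the graphs Γ_x[0,1], of their even walks and of bipartiteness.
-- Classes are given by representatives up to ≈, whereas walks have endpoints fixed up to ≡, so a
-- walk of length 0 must be traded for a walk to a neighbour and back; neighbours exist because
-- a chamber through p and x contains an edge at p, whose second point lies on x by (B₂).

module Submission where

open import Defs
open import Data.Nat using (ℕ; zero; suc; _+_)
open import Data.Nat.Properties using (+-commutativeSemigroup)
open import Algebra.Properties.CommutativeSemigroup +-commutativeSemigroup using (interchange)
open import Data.Fin using (Fin; zero; suc; _≟_)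
open import Data.Maybe using (Maybe; just; nothing)
open import Data.Product using (Σ; ∃-syntax; _×_; _,_; proj₁; proj₂)
open import Data.Sum using (_⊎_; inj₁; inj₂; [_,_])
open import Data.Empty using (⊥-elim)
open import Relation.Nullary using (¬_; yes; no)
open import Relation.Binary.PropositionalEquality
  using (_≡_; _≢_; refl; subst) renaming (sym to ≡-sym; trans to ≡-trans)
open import Relation.Binary.Structures using (IsEquivalence)
open import Function using (_∘_; Equivalence)

module _ {n : ℕ} {Γ : IncidenceSystem n} (geo : IsGeometry Γ) where
  open IncidenceSystem Γ renaming (Carrier to E)
  open IsGeometry geo
  open IsEquivalence isEquiv using () renaming (refl to ≈-refl; sym to ≈-sym; trans to ≈-trans)

  private
    pairFlag : E → E → Fin n → Maybe E
    pairFlag x y i with i ≟ typ x | i ≟ typ y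
    ... | yes _ | _     = just x
    ... | no _  | yes _ = just y
    ... | no _  | no _  = nothing

    pairFlag-just : ∀ x y i {z} → pairFlag x y i ≡ just z → (z ≡ x ⊎ z ≡ y) × typ z ≡ i
    pairFlag-just x y i eq with i ≟ typ x | i ≟ typ y
    pairFlag-just x y i refl | yes i≡x | _       = inj₁ refl , ≡-sym i≡x
    pairFlag-just x y i refl | no _    | yes i≡y = inj₂ refl , ≡-sym i≡y
    pairFlag-just x y i ()   | no _    | no _

    pairFlag-isFlag : ∀ {x y} → x ∗ y → IsFlag Γ (pairFlag x y)
    pairFlag-isFlag {x} {y} x∗y =
      (λ i z eq → proj₂ (pairFlag-just x y i eq)) ,
      (λ i j z w eq eq′ → incident (proj₁ (pairFlag-just x y i eq)) (proj₁ (pairFlag-just x y j eq′)))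
      where
        incident : ∀ {z w} → z ≡ x ⊎ z ≡ y → w ≡ x ⊎ w ≡ y → z ∗ w
        incident (inj₁ refl) (inj₁ refl) = ∗-refl x
        incident (inj₁ refl) (inj₂ refl) = x∗y
        incident (inj₂ refl) (inj₁ refl) = ∗-sym x∗y
        incident (inj₂ refl) (inj₂ refl) = ∗-refl y

    pairFlag-atˡ : ∀ x y → pairFlag x y (typ x) ≡ just x
    pairFlag-atˡ x y with typ x ≟ typ x
    ... | yes _  = refl
    ... | no x≢x = ⊥-elim (x≢x refl)

    pairFlag-atʳ : ∀ {x y} → typ x ≢ typ y → pairFlag x y (typ y) ≡ just y
    pairFlag-atʳ {x} {y} x≢y with typ y ≟ typ x | typ y ≟ typ y
    ... | yes y≡x | _      = ⊥-elim (x≢y (≡-sym y≡x))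
    ... | no _    | yes _  = refl
    ... | no _    | no y≢y = ⊥-elim (y≢y refl)

  incident-pair-in-chamber : ∀ {x y} → x ∗ y → typ x ≢ typ y →
    ∃[ C ] (IsChamber Γ C × x ≈ C (typ x) × y ≈ C (typ y))
  incident-pair-in-chamber {x} {y} x∗y x≢y =
    let (C , chamber , flagIn) = flag-chamber (pairFlag x y) (pairFlag-isFlag x∗y)
    in C , chamber , flagIn _ x (pairFlag-atˡ x y) , flagIn _ y (pairFlag-atʳ x≢y)

  ≈-one-of-pair : ∀ {u v a b r} → a ≈ u ⊎ a ≈ v → b ≈ u ⊎ b ≈ v → ¬ a ≈ b →
                  r ≈ u ⊎ r ≈ v → r ≈ a ⊎ r ≈ b
  ≈-one-of-pair (inj₁ a≈u) (inj₁ b≈u) a≉b _ = ⊥-elim (a≉b (≈-trans a≈u (≈-sym b≈u)))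
  ≈-one-of-pair (inj₂ a≈v) (inj₂ b≈v) a≉b _ = ⊥-elim (a≉b (≈-trans a≈v (≈-sym b≈v)))
  ≈-one-of-pair (inj₁ a≈u) (inj₂ _) _ (inj₁ r≈u) = inj₁ (≈-trans r≈u (≈-sym a≈u))
  ≈-one-of-pair (inj₁ _) (inj₂ b≈v) _ (inj₂ r≈v) = inj₂ (≈-trans r≈v (≈-sym b≈v))
  ≈-one-of-pair (inj₂ _) (inj₁ b≈u) _ (inj₁ r≈u) = inj₂ (≈-trans r≈u (≈-sym b≈u))
  ≈-one-of-pair (inj₂ a≈v) (inj₁ _) _ (inj₂ r≈v) = inj₁ (≈-trans r≈v (≈-sym a≈v))

  module _ {f : E → E} (a : IsAutomorphism Γ f) where
    open IsAutomorphism a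

    inverse : E → E
    inverse y = proj₁ (surj y)

    map-inverse : ∀ y → f (inverse y) ≈ y
    map-inverse y = proj₂ (surj y)

    inverse-map : ∀ x → inverse (f x) ≈ x
    inverse-map x = inj (map-inverse (f x))

    inverse-isAutomorphism : IsAutomorphism Γ inverse
    inverse-isAutomorphism = record
      { resp     = λ x≈y → inj (≈-trans (map-inverse _) (≈-trans x≈y (≈-sym (map-inverse _))))
      ; typ-pres = λ y → ≡-trans (≡-sym (typ-pres (inverse y))) (typ-resp (map-inverse y))
      ; inc      = λ x∗y → inc⁻ (∗-resp (≈-sym (map-inverse _)) (≈-sym (map-inverse _)) x∗y)
      ; inc⁻     = λ x∗y → ∗-resp (map-inverse _) (map-inverse _) (inc x∗y)
      ; inj      = λ x≈y → ≈-trans (≈-sym (map-inverse _)) (≈-trans (resp x≈y) (map-inverse _))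
      ; surj     = λ x → f x , inverse-map x
      }

module _ {m : ℕ} {Γ : IncidenceSystem (suc (suc (suc m)))} where
  open IncidenceSystem Γ renaming (Carrier to E)
  open Construction Γ

  under : PElt → E
  under (pt0 p _)     = p
  under (pt1 p _)     = p
  under (cls x _ _ _) = x

module _ {m : ℕ} {Γ : IncidenceSystem (suc (suc (suc m)))} (geo : IsGeometry Γ) where
  open IncidenceSystem Γ renaming (Carrier to E)
  open IsGeometry geo
  open IsEquivalence isEquiv using () renaming (refl to ≈-refl; sym to ≈-sym; trans to ≈-trans)
  open Construction Γ

  private variable
    x x′ y y′ p p′ q q′ r e e′ : E
    k l : ℕ

  ∈σ₀-resp : p ≈ p′ → x ≈ x′ → p ∈σ₀ x → p′ ∈σ₀ x′
  ∈σ₀-resp p≈p′ x≈x′ (tp , p∗x) = ≡-trans (≡-sym (typ-resp p≈p′)) tp , ∗-resp p≈p′ x≈x′ p∗x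

  AdjIn-resp : x ≈ x′ → p ≈ p′ → q ≈ q′ → AdjIn x p q → AdjIn x′ p′ q′
  AdjIn-resp x≈x′ p≈p′ q≈q′ (p∈x , q∈x , (e , te , e∗x , p∗e , q∗e) , p≉q) =
    ∈σ₀-resp p≈p′ x≈x′ p∈x , ∈σ₀-resp q≈q′ x≈x′ q∈x ,
    (e , te , ∗-resp ≈-refl x≈x′ e∗x , ∗-resp p≈p′ ≈-refl p∗e , ∗-resp q≈q′ ≈-refl q∗e) ,
    λ p′≈q′ → p≉q (≈-trans p≈p′ (≈-trans p′≈q′ (≈-sym q≈q′)))

  AdjIn-sym : AdjIn x p q → AdjIn x q p
  AdjIn-sym (p∈x , q∈x , (e , te , e∗x , p∗e , q∗e) , p≉q) =
    q∈x , p∈x , (e , te , e∗x , q∗e , p∗e) , p≉q ∘ ≈-sym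

  Adj-resp : p ≈ p′ → q ≈ q′ → Adj p q → Adj p′ q′
  Adj-resp p≈p′ q≈q′ (tp , tq , (e , te , p∗e , q∗e) , p≉q) =
    ≡-trans (≡-sym (typ-resp p≈p′)) tp , ≡-trans (≡-sym (typ-resp q≈q′)) tq ,
    (e , te , ∗-resp p≈p′ ≈-refl p∗e , ∗-resp q≈q′ ≈-refl q∗e) ,
    λ p′≈q′ → p≉q (≈-trans p≈p′ (≈-trans p′≈q′ (≈-sym q≈q′)))

  BipartiteIn-resp : x ≈ x′ → BipartiteIn x → BipartiteIn x′
  BipartiteIn-resp x≈x′ (colour , proper) =
    colour , λ p q adj → proper p q (AdjIn-resp (≈-sym x≈x′) ≈-refl ≈-refl adj)

  Upper-resp : x ≈ x′ → Upper (typ x) → Upper (typ x′)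
  Upper-resp x≈x′ = subst Upper (typ-resp x≈x′)

  Upper-suc-suc : ∀ k → Upper (suc (suc k))
  Upper-suc-suc k = (λ ()) , (λ ())

  Joins : E → E → E → Set
  Joins e p q = typ e ≡ suc zero × typ p ≡ zero × typ q ≡ zero × p ∗ e × q ∗ e × ¬ p ≈ q

  Joins-src∗edge : Joins e p q → p ∗ e
  Joins-src∗edge (_ , _ , _ , p∗e , _) = p∗e

  Adj⇒Joins : Adj p q → ∃[ e ] Joins e p q
  Adj⇒Joins (tp , tq , (e , te , p∗e , q∗e) , p≉q) = e , te , tp , tq , p∗e , q∗e , p≉q

  WalkIn-snoc : WalkIn x p q k → AdjIn x q r → WalkIn x p r (suc k)
  WalkIn-snoc (here _)    adj = step adj (here (proj₁ (proj₂ adj)))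
  WalkIn-snoc (step a w) adj = step a (WalkIn-snoc w adj)

  WalkIn-reverse : WalkIn x p q k → WalkIn x q p k
  WalkIn-reverse (here p∈x)  = here p∈x
  WalkIn-reverse (step a w) = WalkIn-snoc (WalkIn-reverse w) (AdjIn-sym a)

  WalkIn-++ : WalkIn x p q k → WalkIn x q r l → WalkIn x p r (k + l)
  WalkIn-++ (here _)    w′ = w′
  WalkIn-++ (step a w) w′ = step a (WalkIn-++ w w′)

  WalkIn-rebase : x ≈ x′ → WalkIn x p q k → WalkIn x′ p q k
  WalkIn-rebase x≈x′ (here p∈x)  = here (∈σ₀-resp ≈-refl x≈x′ p∈x)
  WalkIn-rebase x≈x′ (step a w) = step (AdjIn-resp x≈x′ ≈-refl ≈-refl a) (WalkIn-rebase x≈x′ w)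

  WalkIn-respʳ : q ≈ q′ → WalkIn x p q (suc k) → WalkIn x p q′ (suc k)
  WalkIn-respʳ q≈q′ (step a (here q∈x)) =
    step (AdjIn-resp ≈-refl ≈-refl q≈q′ a) (here (∈σ₀-resp q≈q′ ≈-refl q∈x))
  WalkIn-respʳ q≈q′ (step a w@(step _ _)) = step a (WalkIn-respʳ q≈q′ w)

  EvenIn-refl : p ∈σ₀ x → EvenIn x p p
  EvenIn-refl p∈x = 0 , here p∈x

  EvenIn-sym : EvenIn x p q → EvenIn x q p
  EvenIn-sym (k , w) = k , WalkIn-reverse w

  EvenIn-trans : EvenIn x p q → EvenIn x q r → EvenIn x p r
  EvenIn-trans (k , w) (l , w′) = k + l , subst (WalkIn _ _ _) (interchange k k l l) (WalkIn-++ w w′)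

  EvenIn-rebase : x ≈ x′ → EvenIn x p q → EvenIn x′ p q
  EvenIn-rebase x≈x′ (k , w) = k , WalkIn-rebase x≈x′ w

  module _ {f : E → E} (a : IsAutomorphism Γ f) where
    open IsAutomorphism a

    Upper-map : Upper (typ x) → Upper (typ (f x))
    Upper-map {x} = subst Upper (≡-sym (typ-pres x))

    ∈σ₀-map : p ∈σ₀ x → f p ∈σ₀ f x
    ∈σ₀-map (tp , p∗x) = ≡-trans (typ-pres _) tp , inc p∗x

    AdjIn-map : AdjIn x p q → AdjIn (f x) (f p) (f q)
    AdjIn-map (p∈x , q∈x , (e , te , e∗x , p∗e , q∗e) , p≉q) =
      ∈σ₀-map p∈x , ∈σ₀-map q∈x ,
      (f e , ≡-trans (typ-pres e) te , inc e∗x , inc p∗e , inc q∗e) , p≉q ∘ inj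

    Adj-map : Adj p q → Adj (f p) (f q)
    Adj-map (tp , tq , (e , te , p∗e , q∗e) , p≉q) =
      ≡-trans (typ-pres _) tp , ≡-trans (typ-pres _) tq ,
      (f e , ≡-trans (typ-pres e) te , inc p∗e , inc q∗e) , p≉q ∘ inj

    Joins-map : Joins e p q → Joins (f e) (f p) (f q)
    Joins-map (te , tp , tq , p∗e , q∗e , p≉q) =
      ≡-trans (typ-pres _) te , ≡-trans (typ-pres _) tp , ≡-trans (typ-pres _) tq ,
      inc p∗e , inc q∗e , p≉q ∘ inj

    WalkIn-map : WalkIn x p q k → WalkIn (f x) (f p) (f q) k
    WalkIn-map (here p∈x)  = here (∈σ₀-map p∈x)
    WalkIn-map (step a w) = step (AdjIn-map a) (WalkIn-map w)

    EvenIn-map : EvenIn x p q → EvenIn (f x) (f p) (f q)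
    EvenIn-map (k , w) = k , WalkIn-map w

    BipartiteIn-pull : BipartiteIn (f x) → BipartiteIn x
    BipartiteIn-pull (colour , proper) = colour ∘ f , λ p q adj → proper (f p) (f q) (AdjIn-map adj)

  typ-under : ∀ {i} c → ptyp c ≡ i → i ≢ suc zero → typ (under c) ≡ i
  typ-under (pt0 _ tp)    refl _   = tp
  typ-under (pt1 _ _)     refl i≢1 = ⊥-elim (i≢1 refl)
  typ-under (cls _ _ _ _) refl _   = refl

  under-inc : ∀ c d → Upper (ptyp d) → c ∗P d → under c ∗ under d
  under-inc _             (pt0 _ _)     u _ = ⊥-elim (proj₁ u refl)
  under-inc _             (pt1 _ _)     u _ = ⊥-elim (proj₂ u refl)
  under-inc (pt0 _ _)     (cls _ _ _ _) _ (p∗y , _) = p∗y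
  under-inc (pt1 _ _)     (cls _ _ _ _) _ (p∗y , _) = p∗y
  under-inc (cls _ _ _ _) (cls _ _ _ _) _ (x∗y , _) = x∗y

  Adj-under : ∀ c d → ptyp c ≡ zero → ptyp d ≡ suc zero → c ∗P d → Adj (under c) (under d)
  Adj-under (pt0 _ _)     (pt1 _ _)     _ _ p∼q = p∼q
  Adj-under (pt0 _ _)     (pt0 _ _)     _ ()
  Adj-under (pt0 _ _)     (cls _ u _ _) _ t   = ⊥-elim (proj₂ u t)
  Adj-under (pt1 _ _)     _             ()
  Adj-under (cls _ u _ _) _             t     = ⊥-elim (proj₁ u t)

  -- LiesOver c p x: c lies over the element x of a chamber of Γ whose point is p, that is,
  -- c = (x,0), or c = (q,1) with x the edge pq, or c = (x,P) with p ∈ P.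
  LiesOver : PElt → E → E → Set
  LiesOver (pt0 p′ _)    p x = p′ ≈ x
  LiesOver (pt1 q _)     p e = Joins e p q
  LiesOver (cls y _ r _) p x = y ≈ x × EvenIn y r p

  liesOver-point : ∀ c → ptyp c ≡ zero → LiesOver c p (under c)
  liesOver-point (pt0 _ _)     _ = ≈-refl
  liesOver-point (pt1 _ _)     ()
  liesOver-point (cls _ u _ _) t = ⊥-elim (proj₁ u t)

  liesOver-line : ∀ c → ptyp c ≡ suc zero → Joins e p (under c) → LiesOver c p e
  liesOver-line (pt0 _ _)     ()
  liesOver-line (pt1 _ _)     _ J = J
  liesOver-line (cls _ u _ _) t   = ⊥-elim (proj₂ u t)

  liesOver-upper : ∀ c₀ c → ptyp c₀ ≡ zero → Upper (ptyp c) → c₀ ∗P c →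
                   LiesOver c (under c₀) (under c)
  liesOver-upper _             (pt0 _ _)     _ u = ⊥-elim (proj₁ u refl)
  liesOver-upper _             (pt1 _ _)     _ u = ⊥-elim (proj₂ u refl)
  liesOver-upper (pt0 _ _)     (cls _ _ _ _) _ _ (_ , even) = ≈-refl , even
  liesOver-upper (pt1 _ _)     (cls _ _ _ _) ()
  liesOver-upper (cls _ u _ _) (cls _ _ _ _) t = ⊥-elim (proj₁ u t)

  module _ (b1 : B1) (b2 : B2) where

    Joins-points : Joins e p q → typ r ≡ zero → r ∗ e → r ≈ p ⊎ r ≈ q
    Joins-points (te , tp , tq , p∗e , q∗e , p≉q) tr r∗e =
      let (_ , _ , _ , _ , _ , _ , _ , on-e) = proj₁ b1 _ te
      in ≈-one-of-pair geo (on-e _ tp p∗e) (on-e _ tq q∗e) p≉q (on-e _ tr r∗e)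

    Joins-other : Joins e p q → Joins e′ p′ q′ → e ≈ e′ → p ≈ p′ → q ≈ q′
    Joins-other (_ , _ , tq , _ , q∗e , p≉q) J′ e≈e′ p≈p′
      with Joins-points J′ tq (∗-resp ≈-refl e≈e′ q∗e)
    ... | inj₁ q≈p′ = ⊥-elim (p≉q (≈-trans p≈p′ (≈-sym q≈p′)))
    ... | inj₂ q≈q′ = q≈q′

    Joins-incident : Joins e p q → Upper (typ x) → p ∗ x → q ∗ x → e ∗ x
    Joins-incident J@(te , _) u p∗x q∗x = Equivalence.from (b2 _ _ te u) λ r tr r∗e →
      [ (λ r≈p → ∗-resp (≈-sym r≈p) ≈-refl p∗x) , (λ r≈q → ∗-resp (≈-sym r≈q) ≈-refl q∗x) ]
        (Joins-points J tr r∗e)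

    second-point : typ e ≡ suc zero → typ p ≡ zero → p ∗ e → ∃[ q ] Joins e p q
    second-point te tp p∗e with proj₁ b1 _ te
    ... | p₀ , q₀ , tp₀ , tq₀ , p₀∗e , q₀∗e , p₀≉q₀ , on-e with on-e _ tp p∗e
    ...   | inj₁ p≈p₀ = q₀ , te , tp , tq₀ , p∗e , q₀∗e , λ p≈q₀ → p₀≉q₀ (≈-trans (≈-sym p≈p₀) p≈q₀)
    ...   | inj₂ p≈q₀ = p₀ , te , tp , tp₀ , p∗e , p₀∗e , λ p≈p₀ → p₀≉q₀ (≈-trans (≈-sym p≈p₀) p≈q₀)

    AdjIn-neighbour : Upper (typ x) → p ∈σ₀ x → ∃[ q ] AdjIn x p q
    AdjIn-neighbour {x} u p∈x@(tp , p∗x)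
      with incident-pair-in-chamber geo p∗x (λ tp≡tx → proj₁ u (≡-trans (≡-sym tp≡tx) tp))
    ... | C , (typC , incC) , p≈C , x≈C
      with second-point (typC (suc zero)) tp (∗-resp (≈-sym p≈C) ≈-refl (incC _ (suc zero)))
    ... | q , te , _ , tq , p∗e , q∗e , p≉q =
      q , p∈x , (tq , Equivalence.to (b2 _ x te u) e∗x q tq q∗e) , (_ , te , e∗x , p∗e , q∗e) , p≉q
      where
        e∗x : C (suc zero) ∗ x
        e∗x = ∗-resp ≈-refl (≈-sym x≈C) (incC (suc zero) (typ x))

    EvenIn-respʳ : Upper (typ x) → q ≈ q′ → EvenIn x p q → EvenIn x p q′
    -- A walk of length 0 cannot move its endpoint, so go to a neighbour and back.
    EvenIn-respʳ u p≈q′ (zero , here p∈x) =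
      let (r , p∼r) = AdjIn-neighbour u p∈x
      in 1 , step p∼r (step (AdjIn-resp ≈-refl ≈-refl p≈q′ (AdjIn-sym p∼r))
                            (here (∈σ₀-resp p≈q′ ≈-refl p∈x)))
    EvenIn-respʳ u q≈q′ (suc k , w) = suc k , WalkIn-respʳ q≈q′ w

    EvenIn-resp : Upper (typ x′) → x ≈ x′ → p ≈ p′ → q ≈ q′ → EvenIn x p q → EvenIn x′ p′ q′
    EvenIn-resp u x≈x′ p≈p′ q≈q′ =
      EvenIn-respʳ u q≈q′ ∘ EvenIn-sym ∘ EvenIn-respʳ u p≈p′ ∘ EvenIn-sym ∘ EvenIn-rebase x≈x′

    BarMem-resp : Upper (typ y′) → y ≈ y′ → q ≈ q′ → p ≈ p′ → BarMem y q p → BarMem y′ q′ p′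
    BarMem-resp u y≈y′ q≈q′ p≈p′ (inj₁ (bip , p∈y , ¬even)) =
      inj₁ ( BipartiteIn-resp y≈y′ bip , ∈σ₀-resp p≈p′ y≈y′ p∈y
           , ¬even ∘ EvenIn-resp (Upper-resp (≈-sym y≈y′) u) (≈-sym y≈y′) (≈-sym q≈q′) (≈-sym p≈p′))
    BarMem-resp u y≈y′ q≈q′ p≈p′ (inj₂ (¬bip , even)) =
      inj₂ (¬bip ∘ BipartiteIn-resp (≈-sym y≈y′) , EvenIn-resp u y≈y′ q≈q′ p≈p′ even)

    module _ {f : E → E} (a : IsAutomorphism Γ f) where
      open IsAutomorphism a

      private
        a⁻¹ : IsAutomorphism Γ (inverse geo a)
        a⁻¹ = inverse-isAutomorphism geo a

      EvenIn-pull : Upper (typ x) → EvenIn (f x) (f p) (f q) → EvenIn x p q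
      EvenIn-pull u = EvenIn-resp u (inverse-map geo a _) (inverse-map geo a _) (inverse-map geo a _)
                    ∘ EvenIn-map a⁻¹

      BipartiteIn-map : BipartiteIn x → BipartiteIn (f x)
      BipartiteIn-map = BipartiteIn-pull a⁻¹ ∘ BipartiteIn-resp (≈-sym (inverse-map geo a _))

      Adj-pull : Adj (f p) (f q) → Adj p q
      Adj-pull = Adj-resp (inverse-map geo a _) (inverse-map geo a _) ∘ Adj-map a⁻¹

      BarMem-map : Upper (typ y) → BarMem y q p → BarMem (f y) (f q) (f p)
      BarMem-map u (inj₁ (bip , p∈y , ¬even)) =
        inj₁ (BipartiteIn-map bip , ∈σ₀-map a p∈y , ¬even ∘ EvenIn-pull u)
      BarMem-map u (inj₂ (¬bip , even)) = inj₂ (¬bip ∘ BipartiteIn-pull a , EvenIn-map a even)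

    BarMem-pull : ∀ {f} (a : IsAutomorphism Γ f) →
                  Upper (typ y) → BarMem (f y) (f q) (f p) → BarMem y q p
    BarMem-pull a u =
      BarMem-resp u (inverse-map geo a _) (inverse-map geo a _) (inverse-map geo a _)
      ∘ BarMem-map (inverse-isAutomorphism geo a) (Upper-map a u)

    module _ {f : E → E} (a : IsAutomorphism Γ f) where
      open IsAutomorphism a

      private
        a⁻¹ : IsAutomorphism Γ (inverse geo a)
        a⁻¹ = inverse-isAutomorphism geo a

      Pmap-resp : ∀ {c d} → c ≈P d → Pmap f a c ≈P Pmap f a d
      Pmap-resp {pt0 _ _}     {pt0 _ _}     p≈q          = resp p≈q
      Pmap-resp {pt1 _ _}     {pt1 _ _}     p≈q          = resp p≈q
      Pmap-resp {cls _ _ _ _} {cls _ _ _ _} (x≈y , even) = resp x≈y , EvenIn-map a even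
      Pmap-resp {pt0 _ _}     {pt1 _ _}     ()
      Pmap-resp {pt0 _ _}     {cls _ _ _ _} ()
      Pmap-resp {pt1 _ _}     {pt0 _ _}     ()
      Pmap-resp {pt1 _ _}     {cls _ _ _ _} ()
      Pmap-resp {cls _ _ _ _} {pt0 _ _}     ()
      Pmap-resp {cls _ _ _ _} {pt1 _ _}     ()

      Pmap-typ : ∀ c → ptyp (Pmap f a c) ≡ ptyp c
      Pmap-typ (pt0 _ _)     = refl
      Pmap-typ (pt1 _ _)     = refl
      Pmap-typ (cls x _ _ _) = typ-pres x

      Pmap-inc : ∀ {c d} → c ∗P d → Pmap f a c ∗P Pmap f a d
      Pmap-inc {pt0 _ _}     {pt0 _ _}     p≈q              = resp p≈q
      Pmap-inc {pt1 _ _}     {pt1 _ _}     p≈q              = resp p≈q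
      Pmap-inc {pt0 _ _}     {pt1 _ _}     p∼q              = Adj-map a p∼q
      Pmap-inc {pt1 _ _}     {pt0 _ _}     p∼q              = Adj-map a p∼q
      Pmap-inc {pt0 _ _}     {cls _ _ _ _} (p∗y , even)     = inc p∗y , EvenIn-map a even
      Pmap-inc {cls _ _ _ _} {pt0 _ _}     (p∗y , even)     = inc p∗y , EvenIn-map a even
      Pmap-inc {pt1 _ _}     {cls _ u _ _} (p∗y , bar)      = inc p∗y , BarMem-map a u bar
      Pmap-inc {cls _ u _ _} {pt1 _ _}     (p∗y , bar)      = inc p∗y , BarMem-map a u bar
      Pmap-inc {cls _ _ _ _} {cls _ _ _ _} (x∗y , r , even₁ , even₂) =
        inc x∗y , f r , EvenIn-map a even₁ , EvenIn-map a even₂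

      Pmap-inc⁻ : ∀ {c d} → Pmap f a c ∗P Pmap f a d → c ∗P d
      Pmap-inc⁻ {pt0 _ _}     {pt0 _ _}     p≈q              = inj p≈q
      Pmap-inc⁻ {pt1 _ _}     {pt1 _ _}     p≈q              = inj p≈q
      Pmap-inc⁻ {pt0 _ _}     {pt1 _ _}     p∼q              = Adj-pull a p∼q
      Pmap-inc⁻ {pt1 _ _}     {pt0 _ _}     p∼q              = Adj-pull a p∼q
      Pmap-inc⁻ {pt0 _ _}     {cls _ u _ _} (p∗y , even)     = inc⁻ p∗y , EvenIn-pull a u even
      Pmap-inc⁻ {cls _ u _ _} {pt0 _ _}     (p∗y , even)     = inc⁻ p∗y , EvenIn-pull a u even
      Pmap-inc⁻ {pt1 _ _}     {cls _ u _ _} (p∗y , bar)      = inc⁻ p∗y , BarMem-pull a u bar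
      Pmap-inc⁻ {cls _ u _ _} {pt1 _ _}     (p∗y , bar)      = inc⁻ p∗y , BarMem-pull a u bar
      Pmap-inc⁻ {cls x u _ _} {cls y v _ _} (x∗y , r , even₁ , even₂) =
        inc⁻ x∗y , inverse geo a r , pull u even₁ , pull v even₂
        where
          pull : ∀ {z p} → Upper (typ z) → EvenIn (f z) (f p) r → EvenIn z p (inverse geo a r)
          pull u′ = EvenIn-pull a u′ ∘ EvenIn-respʳ (Upper-map a u′) (≈-sym (map-inverse geo a r))

      Pmap-inj : ∀ {c d} → Pmap f a c ≈P Pmap f a d → c ≈P d
      Pmap-inj {pt0 _ _}     {pt0 _ _}     p≈q          = inj p≈q
      Pmap-inj {pt1 _ _}     {pt1 _ _}     p≈q          = inj p≈q
      Pmap-inj {cls _ u _ _} {cls _ _ _ _} (x≈y , even) = inj x≈y , EvenIn-pull a u even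
      Pmap-inj {pt0 _ _}     {pt1 _ _}     ()
      Pmap-inj {pt0 _ _}     {cls _ _ _ _} ()
      Pmap-inj {pt1 _ _}     {pt0 _ _}     ()
      Pmap-inj {pt1 _ _}     {cls _ _ _ _} ()
      Pmap-inj {cls _ _ _ _} {pt0 _ _}     ()
      Pmap-inj {cls _ _ _ _} {pt1 _ _}     ()

      Pmap-surj : ∀ d → ∃[ c ] (Pmap f a c ≈P d)
      Pmap-surj (pt0 p tp) =
        pt0 (inverse geo a p) (≡-trans (IsAutomorphism.typ-pres a⁻¹ p) tp) , map-inverse geo a p
      Pmap-surj (pt1 p tp) =
        pt1 (inverse geo a p) (≡-trans (IsAutomorphism.typ-pres a⁻¹ p) tp) , map-inverse geo a p
      Pmap-surj (cls y u q q∈y) =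
        cls (inverse geo a y) (Upper-map a⁻¹ u) (inverse geo a q) (∈σ₀-map a⁻¹ q∈y) ,
        map-inverse geo a y ,
        EvenIn-respʳ (Upper-map a (Upper-map a⁻¹ u)) (map-inverse geo a q)
          (EvenIn-refl (∈σ₀-map a (∈σ₀-map a⁻¹ q∈y)))

      Pmap-isAutomorphism : IsAutomorphism PΓ (Pmap f a)
      Pmap-isAutomorphism = record
        { resp     = λ {c} {d} → Pmap-resp {c} {d}
        ; typ-pres = Pmap-typ
        ; inc      = λ {c} {d} → Pmap-inc {c} {d}
        ; inc⁻     = λ {c} {d} → Pmap-inc⁻ {c} {d}
        ; inj      = λ {c} {d} → Pmap-inj {c} {d}
        ; surj     = Pmap-surj
        }

    module ChamberBelow (C : Fin (suc (suc (suc m))) → PElt) (chC : IsChamber PΓ C) where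
      private
        typC : ∀ i → ptyp (C i) ≡ i
        typC = proj₁ chC

        incC : ∀ i j → C i ∗P C j
        incC = proj₂ chC

        joined : ∃[ e ] Joins e (under (C zero)) (under (C (suc zero)))
        joined = Adj⇒Joins (Adj-under (C zero) (C (suc zero)) (typC zero) (typC (suc zero))
                                      (incC zero (suc zero)))

        edge : E
        edge = proj₁ joined

        J : Joins edge (under (C zero)) (under (C (suc zero)))
        J = proj₂ joined

      C̄ : Fin (suc (suc (suc m))) → E
      C̄ zero          = under (C zero)
      C̄ (suc zero)    = edge
      C̄ (suc (suc k)) = under (C (suc (suc k)))

      private
        upper : ∀ k → Upper (ptyp (C (suc (suc k))))
        upper k = subst Upper (≡-sym (typC (suc (suc k)))) (Upper-suc-suc k)

        typ-C̄ : ∀ i → typ (C̄ i) ≡ i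
        typ-C̄ zero          = typ-under (C zero) (typC zero) (λ ())
        typ-C̄ (suc zero)    = proj₁ J
        typ-C̄ (suc (suc k)) = typ-under (C (suc (suc k))) (typC (suc (suc k))) (λ ())

        under-inc-upper : ∀ i k → under (C i) ∗ C̄ (suc (suc k))
        under-inc-upper i k = under-inc (C i) (C (suc (suc k))) (upper k) (incC i (suc (suc k)))

        inc-upper : ∀ i k → C̄ i ∗ C̄ (suc (suc k))
        inc-upper zero          k = under-inc-upper zero k
        inc-upper (suc zero)    k =
          Joins-incident J (subst Upper (≡-sym (typ-C̄ (suc (suc k)))) (Upper-suc-suc k))
            (under-inc-upper zero k) (under-inc-upper (suc zero) k)
        inc-upper (suc (suc l)) k = under-inc-upper (suc (suc l)) k

        inc-C̄ : ∀ i j → C̄ i ∗ C̄ j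
        inc-C̄ zero          zero          = ∗-refl _
        inc-C̄ zero          (suc zero)    = Joins-src∗edge J
        inc-C̄ (suc zero)    zero          = ∗-sym (Joins-src∗edge J)
        inc-C̄ (suc zero)    (suc zero)    = ∗-refl _
        inc-C̄ i             (suc (suc k)) = inc-upper i k
        inc-C̄ (suc (suc k)) j             = ∗-sym (inc-upper j k)

      C̄-isChamber : IsChamber Γ C̄
      C̄-isChamber = typ-C̄ , inc-C̄

      liesOver : ∀ i → LiesOver (C i) (C̄ zero) (C̄ i)
      liesOver zero          = liesOver-point (C zero) (typC zero)
      liesOver (suc zero)    = liesOver-line (C (suc zero)) (typC (suc zero)) J
      liesOver (suc (suc k)) =
        liesOver-upper (C zero) (C (suc (suc k))) (typC zero) (upper k) (incC zero (suc (suc k)))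

    chamber-below : ∀ C → IsChamber PΓ C →
      ∃[ C̄ ] (IsChamber Γ C̄ × ∀ i → LiesOver (C i) (C̄ zero) (C̄ i))
    chamber-below C chC = C̄ , C̄-isChamber , liesOver
      where open ChamberBelow C chC

    Pmap-liesOver : ∀ {f} (a : IsAutomorphism Γ f) c d {p p′ x x′} → ptyp c ≡ ptyp d →
      LiesOver c p x → LiesOver d p′ x′ → f p ≈ p′ → f x ≈ x′ → Pmap f a c ≈P d
    Pmap-liesOver a (pt0 _ _) (pt0 _ _) _ q≈x q′≈x′ _ fx≈x′ =
      ≈-trans (IsAutomorphism.resp a q≈x) (≈-trans fx≈x′ (≈-sym q′≈x′))
    Pmap-liesOver a (pt1 _ _) (pt1 _ _) _ J J′ fp≈p′ fe≈e′ = Joins-other (Joins-map a J) J′ fe≈e′ fp≈p′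
    Pmap-liesOver {f} a (cls y u r _) (cls y′ _ r′ _) {p′ = p′} _ (y≈x , even) (y′≈x′ , even′)
                  fp≈p′ fx≈x′ =
      fy≈y′ , EvenIn-trans fr~p′ p′~r′
      where
        fy≈y′ : f y ≈ y′
        fy≈y′ = ≈-trans (IsAutomorphism.resp a y≈x) (≈-trans fx≈x′ (≈-sym y′≈x′))

        fr~p′ : EvenIn (f y) (f r) p′
        fr~p′ = EvenIn-respʳ (Upper-map a u) fp≈p′ (EvenIn-map a even)

        p′~r′ : EvenIn (f y) p′ r′
        p′~r′ = EvenIn-rebase (≈-sym fy≈y′) (EvenIn-sym even′)
    Pmap-liesOver a (pt0 _ _)     (pt1 _ _)     ()
    Pmap-liesOver a (pt1 _ _)     (pt0 _ _)     ()
    Pmap-liesOver a (pt0 _ _)     (cls _ v _ _) t = ⊥-elim (proj₁ v (≡-sym t))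
    Pmap-liesOver a (pt1 _ _)     (cls _ v _ _) t = ⊥-elim (proj₂ v (≡-sym t))
    Pmap-liesOver a (cls _ u _ _) (pt0 _ _)     t = ⊥-elim (proj₁ u t)
    Pmap-liesOver a (cls _ u _ _) (pt1 _ _)     t = ⊥-elim (proj₂ u t)

    Pmap-chamberTransitive : ∀ {G} (grp : IsAutGroup Γ G) → ChamberTransitive Γ G →
      ∀ C D → IsChamber PΓ C → IsChamber PΓ D →
      ∃[ σ ] Σ (G σ) (λ g → ∀ i → Pmap σ (IsAutGroup.aut grp σ g) (C i) ≈P D i)
    Pmap-chamberTransitive grp transitive C D chC chD
      with chamber-below C chC | chamber-below D chD
    ... | C̄ , chC̄ , overC | D̄ , chD̄ , overD with transitive C̄ D̄ chC̄ chD̄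
    ... | σ , g , σC̄≈D̄ = σ , g , λ i →
      Pmap-liesOver (IsAutGroup.aut grp σ g) (C i) (D i) (≡-trans (proj₁ chC i) (≡-sym (proj₁ chD i)))
        (overC i) (overD i) (σC̄≈D̄ zero) (σC̄≈D̄ i)

-- Residual connectedness and non-bipartiteness of Γ[0,1] are needed for neither conclusion.
proposition3p14 : ∀ {m : ℕ} (Γ : IncidenceSystem (3 + m)) →
    IsGeometry Γ →
    ResiduallyConnected Γ →
    Construction.B1 Γ →
    Construction.B2 Γ →
    ¬ Construction.Bipartite Γ →
    (G : (Carrier Γ → Carrier Γ) → Set) →
    (grp : IsAutGroup Γ G) →
    ChamberTransitive Γ G →
    (∀ σ (g : G σ) →
       IsAutomorphism (Construction.PΓ Γ)
         (Construction.Pmap Γ σ (IsAutGroup.aut grp σ g)))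
    ×
    (∀ C D → IsChamber (Construction.PΓ Γ) C → IsChamber (Construction.PΓ Γ) D →
       ∃[ σ ] Σ (G σ) (λ g → ∀ i →
         Construction._≈P_ Γ (Construction.Pmap Γ σ (IsAutGroup.aut grp σ g) (C i)) (D i)))
proposition3p14 _ geo _ b1 b2 _ _ grp transitive =
  (λ σ g → Pmap-isAutomorphism geo b1 b2 (IsAutGroup.aut grp σ g)) ,
  Pmap-chamberTransitive geo b1 b2 grp transitive
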